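{- Let $D$ be the unique derivation (linear map satisfying $D(uv)=D(u)v+uD(v)$) on the polynomial ring $\mathbb{Q}[L,M,x,y,s]$ with $$D(L)=Ly,\quad D(M)=Ms,\quad D(s)=xy,\quad D(x)=xy,\quad D(y)=xy.$$ Then for every $n\geqslant 0$, $$D^n(LM)=LM\sum_{\pi\in\mathfrak{S}_{n+1}}x^{{\rm basc}(\pi)}y^{{\rm des}(\pi)}s^{{\rm suc}(\pi)}.$$
   Context: For $\pi\in\mathfrak{S}_n$: ${\rm des}(\pi)=\#\{i\in[n-1]:\pi(i)>\pi(i+1)\}$, ${\rm suc}(\pi)=\#\{i\in[n-1]:\pi(i+1)=\pi(i)+1\}$, ${\rm basc}(\pi)=\#\{i\in[n-1]:\pi(i+1)\geqslant\pi(i)+2\}$. -}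

module Defs where

open import Data.Nat as ℕ using (ℕ; zero; suc)
open import Data.Rational as ℚ using (ℚ; 0ℚ; 1ℚ)
open import Data.Vec as Vec using (Vec; []; _∷_)
open import Data.Vec.Properties using (≡-dec)
open import Data.List as List using (List; []; _∷_; upTo; filter; concatMap; map; foldr)
open import Data.Product using (_×_; _,_)
open import Data.Bool using (Bool; true; false; if_then_else_)
open import Relation.Nullary using (does)
open import Relation.Binary.PropositionalEquality using (_≡_)
import Data.List.Relation.Unary.Unique.DecPropositional as UniqueDec

-- Polynomials in ℚ[L,M,x,y,s]
-- A monomial is its exponent vector (exponents of L, M, x, y, s in order).

Mono : Set
Mono = Vec ℕ 5

Poly : Set
Poly = List (ℚ × Mono)

_≟ₘ_ : (m m' : Mono) → Relation.Nullary.Dec (m ≡ m')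
_≟ₘ_ = ≡-dec ℕ._≟_

coeff : Poly → Mono → ℚ
coeff []             m = 0ℚ
coeff ((c , m') ∷ p) m = (if does (m' ≟ₘ m) then c else 0ℚ) ℚ.+ coeff p m

infix 4 _≈_
_≈_ : Poly → Poly → Set
p ≈ q = ∀ m → coeff p m ≡ coeff q m

0P : Poly
0P = []

1P : Poly
1P = (1ℚ , 0 ∷ 0 ∷ 0 ∷ 0 ∷ 0 ∷ []) ∷ []

infixl 6 _+P_
_+P_ : Poly → Poly → Poly
p +P q = p List.++ q

infixl 7 _*P_ _·P_
_*P_ : Poly → Poly → Poly
p *P q = concatMap (λ { (c , m) → map (λ { (c' , m') → (c ℚ.* c' , Vec.zipWith ℕ._+_ m m') }) q }) p

_·P_ : ℚ → Poly → Poly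
a ·P p = map (λ { (c , m) → (a ℚ.* c , m) }) p

infixr 8 _^P_
_^P_ : Poly → ℕ → Poly
p ^P zero  = 1P
p ^P suc k = p *P (p ^P k)

sumP : List Poly → Poly
sumP = foldr _+P_ 0P

varL varM varx vary vars : Poly
varL = (1ℚ , 1 ∷ 0 ∷ 0 ∷ 0 ∷ 0 ∷ []) ∷ []
varM = (1ℚ , 0 ∷ 1 ∷ 0 ∷ 0 ∷ 0 ∷ []) ∷ []
varx = (1ℚ , 0 ∷ 0 ∷ 1 ∷ 0 ∷ 0 ∷ []) ∷ []
vary = (1ℚ , 0 ∷ 0 ∷ 0 ∷ 1 ∷ 0 ∷ []) ∷ []
vars = (1ℚ , 0 ∷ 0 ∷ 0 ∷ 0 ∷ 1 ∷ []) ∷ []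

record IsDerivation (D : Poly → Poly) : Set where
  field
    resp     : ∀ {p q} → p ≈ q → D p ≈ D q
    additive : ∀ p q → D (p +P q) ≈ D p +P D q
    homog    : ∀ a p → D (a ·P p) ≈ a ·P D p
    leibniz  : ∀ p q → D (p *P q) ≈ D p *P q +P p *P D q

iter : ℕ → (Poly → Poly) → Poly → Poly
iter zero    f p = p
iter (suc n) f p = f (iter n f p)

-- Permutations of [m] in one-line notation, written with values 0..m-1
-- (i.e. π(1)-1, ..., π(m)-1; the statistics below are shift-invariant):
-- all length-m words over {0..m-1} with pairwise distinct letters.

words : ℕ → List ℕ → List (List ℕ)
words zero    A = [] ∷ []
words (suc k) A = concatMap (λ a → map (a ∷_) (words k A)) A

perms : ℕ → List (List ℕ)
perms m = filter (UniqueDec.unique? ℕ._≟_) (words m (upTo m))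

countAdj : (ℕ → ℕ → Bool) → List ℕ → ℕ
countAdj P []            = 0
countAdj P (a ∷ [])      = 0
countAdj P (a ∷ b ∷ w)   = (if P a b then 1 else 0) ℕ.+ countAdj P (b ∷ w)

des : List ℕ → ℕ
des = countAdj (λ a b → does (b ℕ.<? a))

sucs : List ℕ → ℕ
sucs = countAdj (λ a b → does (b ℕ.≟ suc a))

basc : List ℕ → ℕ
basc = countAdj (λ a b → does (suc (suc a) ℕ.≤? b))

{-# OPTIONS --safe #-}
module Submission where

-- Write m(π) = x^basc(π) y^des(π) s^suc(π). As D(LM) = LM (y + s), the Leibniz rule gives
-- D(LM m(π)) = LM (y m(π) + s m(π) + D m(π)), where D m(π) is the sum, over the adjacent
-- pairs of π, of m(π) with the factor x, y or s of that pair replaced by xy.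
-- These are exactly the monomials of the n + 2 permutations obtained by inserting a new
-- maximum n + 1 into π ∈ 𝔖_{n+1}: in front it creates a descent (y); between a and b with
-- a < n it creates a big ascent and a descent (xy in place of the factor of (a, b)); right
-- after n it turns the descent (n, b) into a succession and a descent (an extra s); at the
-- end it adds a big ascent (x), matching the term of the pair following n, or a succession
-- (s) if π ends with n. Each permutation in 𝔖_{n+2} arises from exactly one such insertion,
-- so the formula follows by induction on n.

open import Defs
open import Data.Nat as ℕ using (ℕ; zero; suc; _<_; _≤_; s≤s; z≤n)
import Data.Nat.Properties as ℕ
open import Data.Rational as ℚ using (ℚ; 0ℚ; 1ℚ)
import Data.Rational.Properties as ℚ
open import Data.Vec as Vec using (Vec; []; _∷_)
import Data.Vec.Properties as Vec
open import Data.List as List using (List; []; _∷_; _++_; map; concatMap; length; upTo; _∷ʳ_)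
import Data.List.Properties as List
open import Data.List.Relation.Binary.Permutation.Propositional as ↭
  using (_↭_; prep; swap; ↭-refl; ↭-sym; ↭-trans; ↭-reflexive; ↭⇒↭ₛ)
import Data.List.Relation.Binary.Permutation.Propositional.Properties as ↭
open import Data.List.Relation.Unary.All as All using (All; []; _∷_)
open import Data.List.Relation.Unary.Any using (here; there)
open import Data.List.Membership.Propositional using (_∈_; _∉_; find; lose)
open import Data.List.Membership.Propositional.Properties
  using (∈-map⁺; ∈-map⁻; ∈-concatMap⁺; ∈-concatMap⁻; ∈-filter⁺; ∈-filter⁻; ∈-upTo⁺; ∈-upTo⁻; ∈-∃++)
open import Data.List.Membership.Propositional.Properties.WithK using (unique∧set⇒bag)
open import Data.List.Membership.DecPropositional ℕ._≟_ using (_∈?_)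
open import Data.List.Relation.Binary.BagAndSetEquality using (∼bag⇒↭)
import Data.List.Relation.Binary.Permutation.Setoid.Properties as ↭ₛ
open import Data.List.Relation.Unary.All.Properties.Core using (¬Any⇒All¬; All¬⇒¬Any)
open import Data.List.Relation.Unary.Unique.Propositional using (Unique)
import Data.List.Relation.Unary.Unique.Propositional.Properties as Unique
open import Data.List.Relation.Unary.Unique.DecPropositional ℕ._≟_ using (unique?)
open import Data.List.Relation.Unary.AllPairs using ([]; _∷_)
open import Data.List.Relation.Unary.Linked using (Linked; []; [-]; _∷_)
open import Data.List.Relation.Unary.Linked.Properties using (AllPairs⇒Linked)
open import Function.Bundles using (mk⇔)
open import Data.Product using (_×_; _,_; proj₁; proj₂; ∃)
open import Data.Sum using (inj₁; inj₂)
open import Relation.Binary.Definitions using (tri<; tri≈; tri>)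
open import Data.Bool using (if_then_else_)
open import Data.Empty using (⊥-elim)
open import Function using (_∘_; _$_)
open import Relation.Nullary using (Dec; does; yes; no; ¬_; ¬?)
open import Relation.Nullary.Decidable using (dec-true; dec-false)
open import Relation.Binary using (IsEquivalence; Setoid)
open import Relation.Binary.PropositionalEquality
  using (_≡_; _≢_; refl; sym; trans; cong; cong₂; subst; setoid; module ≡-Reasoning)
import Relation.Binary.Reasoning.Setoid as SetoidReasoning
import Algebra.Properties.Group as GroupProperties
open import Algebra.Bundles using (CommutativeMonoid)
import Algebra.Properties.CommutativeSemigroup as CommSemigroupProperties

-- Polynomial arithmetic up to coefficientwise equality

infixl 6 _⊕_ _⊖_
_⊕_ _⊖_ : ∀ {k} → Vec ℕ k → Vec ℕ k → Vec ℕ k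
_⊕_ = Vec.zipWith ℕ._+_
_⊖_ = Vec.zipWith ℕ._∸_

⊕-comm : ∀ {k} (e f : Vec ℕ k) → e ⊕ f ≡ f ⊕ e
⊕-comm = Vec.zipWith-comm ℕ.+-comm

⊕-assoc : ∀ {k} (e f g : Vec ℕ k) → e ⊕ f ⊕ g ≡ e ⊕ (f ⊕ g)
⊕-assoc = Vec.zipWith-assoc ℕ.+-assoc

⊕-identityˡ : ∀ {k} (e : Vec ℕ k) → Vec.replicate k 0 ⊕ e ≡ e
⊕-identityˡ = Vec.zipWith-identityˡ ℕ.+-identityˡ

⊕-identityʳ : ∀ {k} (e : Vec ℕ k) → e ⊕ Vec.replicate k 0 ≡ e
⊕-identityʳ = Vec.zipWith-identityʳ ℕ.+-identityʳ

⊕-leftComm : ∀ {k} (e f g : Vec ℕ k) → e ⊕ (f ⊕ g) ≡ f ⊕ (e ⊕ g)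
⊕-leftComm e f g = begin
  e ⊕ (f ⊕ g) ≡⟨ ⊕-assoc e f g ⟨
  e ⊕ f ⊕ g   ≡⟨ cong (_⊕ g) (⊕-comm e f) ⟩
  f ⊕ e ⊕ g   ≡⟨ ⊕-assoc f e g ⟩
  f ⊕ (e ⊕ g) ∎
  where open ≡-Reasoning

⊕-⊖ : ∀ {k} (e f : Vec ℕ k) → e ⊕ f ⊖ f ≡ e
⊕-⊖ []      []      = refl
⊕-⊖ (a ∷ e) (b ∷ f) = cong₂ _∷_ (ℕ.m+n∸n≡m a b) (⊕-⊖ e f)

⊕-cancelʳ : ∀ {k} {e g : Vec ℕ k} f → e ⊕ f ≡ g ⊕ f → e ≡ g
⊕-cancelʳ {e = e} {g} f eq = trans (sym (⊕-⊖ e f)) (trans (cong (_⊖ f) eq) (⊕-⊖ g f))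

-- `_≈_` unfolds to a Π-type, from which Agda cannot recover the two
-- polynomials; wrapped in a record it can, which makes reasoning chains work.
infix 4 _≋_
record _≋_ (p q : Poly) : Set where
  constructor coeffwise
  field coeff-≡ : p ≈ q
open _≋_ public

≋-isEquivalence : IsEquivalence _≋_
≋-isEquivalence = record
  { refl  = coeffwise λ _ → refl
  ; sym   = λ (coeffwise e) → coeffwise λ m → sym (e m)
  ; trans = λ (coeffwise e) (coeffwise f) → coeffwise λ m → trans (e m) (f m)
  }

≋-setoid : Setoid _ _
≋-setoid = record { isEquivalence = ≋-isEquivalence }

module ≋-Reasoning = SetoidReasoning ≋-setoid

≡⇒≋ : ∀ {p q} → p ≡ q → p ≋ q
≡⇒≋ refl = IsEquivalence.refl ≋-isEquivalence

coeff₁ : ℚ × Mono → Mono → ℚ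
coeff₁ (c , e) m = if does (e ≟ₘ m) then c else 0ℚ

coeff-++ : ∀ p q m → coeff (p ++ q) m ≡ coeff p m ℚ.+ coeff q m
coeff-++ []      q m = sym (ℚ.+-identityˡ _)
coeff-++ (t ∷ p) q m =
  trans (cong (coeff₁ t m ℚ.+_) (coeff-++ p q m)) (sym (ℚ.+-assoc (coeff₁ t m) (coeff p m) _))

+P-cong : ∀ {p p′ q q′} → p ≋ p′ → q ≋ q′ → p +P q ≋ p′ +P q′
+P-cong {p} {p′} {q} {q′} (coeffwise e) (coeffwise f) = coeffwise λ m → begin
  coeff (p ++ q) m           ≡⟨ coeff-++ p q m ⟩
  coeff p m ℚ.+ coeff q m    ≡⟨ cong₂ ℚ._+_ (e m) (f m) ⟩
  coeff p′ m ℚ.+ coeff q′ m  ≡⟨ coeff-++ p′ q′ m ⟨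
  coeff (p′ ++ q′) m         ∎
  where open ≡-Reasoning

↭⇒≋ : ∀ {p q} → p ↭ q → p ≋ q
↭⇒≋ p↭q = coeffwise λ m → go p↭q m
  where
  go : ∀ {p q} → p ↭ q → p ≈ q
  go ↭.refl                   m = refl
  go (prep t p↭q)             m = cong (coeff₁ t m ℚ.+_) (go p↭q m)
  go (swap {xs} {ys} s t p↭q) m = begin
    a ℚ.+ (b ℚ.+ coeff xs m)  ≡⟨ ℚ.+-assoc a b _ ⟨
    a ℚ.+ b ℚ.+ coeff xs m    ≡⟨ cong₂ ℚ._+_ (ℚ.+-comm a b) (go p↭q m) ⟩
    b ℚ.+ a ℚ.+ coeff ys m    ≡⟨ ℚ.+-assoc b a _ ⟩
    b ℚ.+ (a ℚ.+ coeff ys m)  ∎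
    where
    open ≡-Reasoning
    a b : ℚ
    a = coeff₁ s m
    b = coeff₁ t m
  go (↭.trans p↭q q↭r)        m = trans (go p↭q m) (go q↭r m)

∑ : {A : Set} → List A → (A → ℚ) → ℚ
∑ []       f = 0ℚ
∑ (x ∷ xs) f = f x ℚ.+ ∑ xs f

∑-cong : {A : Set} (xs : List A) {f g : A → ℚ} → (∀ x → f x ≡ g x) → ∑ xs f ≡ ∑ xs g
∑-cong []       f≗g = refl
∑-cong (x ∷ xs) f≗g = cong₂ ℚ._+_ (f≗g x) (∑-cong xs f≗g)

∑-zero : {A : Set} (xs : List A) → ∑ xs (λ _ → 0ℚ) ≡ 0ℚ
∑-zero []       = refl
∑-zero (x ∷ xs) = trans (ℚ.+-identityˡ _) (∑-zero xs)

∑-+ : {A : Set} (xs : List A) (f g : A → ℚ) → ∑ xs (λ x → f x ℚ.+ g x) ≡ ∑ xs f ℚ.+ ∑ xs g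
∑-+ []       f g = sym (ℚ.+-identityˡ 0ℚ)
∑-+ (x ∷ xs) f g = trans (cong (f x ℚ.+ g x ℚ.+_) (∑-+ xs f g)) (interchange (f x) (g x) _ _)
  where open CommSemigroupProperties (CommutativeMonoid.commutativeSemigroup ℚ.+-0-commutativeMonoid)
          using (interchange)

coeff-map : ∀ (h : ℚ × Mono → ℚ × Mono) p m → coeff (map h p) m ≡ ∑ p (λ t → coeff₁ (h t) m)
coeff-map h []      m = refl
coeff-map h (t ∷ p) m = cong (coeff₁ (h t) m ℚ.+_) (coeff-map h p m)

infixl 7 _*ₜ_
_*ₜ_ : Poly → ℚ × Mono → Poly
p *ₜ (k , f) = map (λ (c , e) → (c ℚ.* k , e ⊕ f)) p

coeff-*ₜ-⊕ : ∀ k f g p → coeff (p *ₜ (k , f)) (g ⊕ f) ≡ coeff p g ℚ.* k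
coeff-*ₜ-⊕ k f g []            = sym (ℚ.*-zeroˡ k)
coeff-*ₜ-⊕ k f g ((c , e) ∷ p) with (e ⊕ f) ≟ₘ (g ⊕ f) | e ≟ₘ g
... | yes _  | yes _    = trans (cong (c ℚ.* k ℚ.+_) (coeff-*ₜ-⊕ k f g p)) (sym (ℚ.*-distribʳ-+ k c _))
... | no ne  | yes refl = ⊥-elim (ne refl)
... | yes eq | no ne    = ⊥-elim (ne (⊕-cancelʳ f eq))
... | no _   | no _     =
  trans (ℚ.+-identityˡ _) (trans (coeff-*ₜ-⊕ k f g p) (cong (ℚ._* k) (sym (ℚ.+-identityˡ (coeff p g)))))

coeff-*ₜ-∉ : ∀ k f m p → (∀ g → g ⊕ f ≢ m) → coeff (p *ₜ (k , f)) m ≡ 0ℚ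
coeff-*ₜ-∉ k f m []            ∉img = refl
coeff-*ₜ-∉ k f m ((c , e) ∷ p) ∉img with (e ⊕ f) ≟ₘ m
... | yes eq = ⊥-elim (∉img e eq)
... | no _   = trans (ℚ.+-identityˡ _) (coeff-*ₜ-∉ k f m p ∉img)

*ₜ-cong : ∀ {p p′} t → p ≋ p′ → p *ₜ t ≋ p′ *ₜ t
*ₜ-cong {p} {p′} (k , f) (coeffwise e) = coeffwise λ m → go m ((m ⊖ f ⊕ f) ≟ₘ m)
  where
  go : ∀ m → Dec (m ⊖ f ⊕ f ≡ m) → coeff (p *ₜ (k , f)) m ≡ coeff (p′ *ₜ (k , f)) m
  go m (yes eq) = subst (λ m → coeff (p *ₜ (k , f)) m ≡ coeff (p′ *ₜ (k , f)) m) eq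
    (trans (coeff-*ₜ-⊕ k f _ p) (trans (cong (ℚ._* k) (e _)) (sym (coeff-*ₜ-⊕ k f _ p′))))
  go m (no ne)  = trans (coeff-*ₜ-∉ k f m p ∉img) (sym (coeff-*ₜ-∉ k f m p′ ∉img))
    where
    ∉img : ∀ g → g ⊕ f ≢ m
    ∉img g refl = ne (cong (_⊕ f) (⊕-⊖ g f))

coeff-*P-∑ˡ : ∀ p q m → coeff (p *P q) m ≡ ∑ q (λ t → coeff (p *ₜ t) m)
coeff-*P-∑ˡ []            q m = sym (∑-zero q)
coeff-*P-∑ˡ ((c , e) ∷ p) q m = begin
  coeff (map row q ++ p *P q) m
    ≡⟨ coeff-++ (map row q) (p *P q) m ⟩
  coeff (map row q) m ℚ.+ coeff (p *P q) m
    ≡⟨ cong₂ ℚ._+_ (coeff-map row q m) (coeff-*P-∑ˡ p q m) ⟩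
  ∑ q (λ t → coeff₁ (row t) m) ℚ.+ ∑ q (λ t → coeff (p *ₜ t) m)
    ≡⟨ ∑-+ q _ _ ⟨
  ∑ q (λ t → coeff (((c , e) ∷ p) *ₜ t) m) ∎
  where
  open ≡-Reasoning
  row : ℚ × Mono → ℚ × Mono
  row (k , f) = (c ℚ.* k , e ⊕ f)

coeff-*P-∑ʳ : ∀ p q m → coeff (p *P q) m ≡ ∑ p (λ t → coeff (q *ₜ t) m)
coeff-*P-∑ʳ []            q m = refl
coeff-*P-∑ʳ ((c , e) ∷ p) q m = begin
  coeff (map row q ++ p *P q) m
    ≡⟨ coeff-++ (map row q) (p *P q) m ⟩
  coeff (map row q) m ℚ.+ coeff (p *P q) m
    ≡⟨ cong₂ ℚ._+_ (cong (λ r → coeff r m) (List.map-cong row≗ q)) (coeff-*P-∑ʳ p q m) ⟩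
  coeff (q *ₜ (c , e)) m ℚ.+ ∑ p (λ t → coeff (q *ₜ t) m) ∎
  where
  open ≡-Reasoning
  row : ℚ × Mono → ℚ × Mono
  row (k , f) = (c ℚ.* k , e ⊕ f)
  row≗ : ∀ t → row t ≡ (proj₁ t ℚ.* c , proj₂ t ⊕ e)
  row≗ (k , f) = cong₂ _,_ (ℚ.*-comm c k) (⊕-comm e f)

*P-congˡ : ∀ {p p′} q → p ≋ p′ → p *P q ≋ p′ *P q
*P-congˡ {p} {p′} q p≋p′ = coeffwise λ m → begin
  coeff (p *P q) m                ≡⟨ coeff-*P-∑ˡ p q m ⟩
  ∑ q (λ t → coeff (p *ₜ t) m)    ≡⟨ ∑-cong q (λ t → coeff-≡ (*ₜ-cong t p≋p′) m) ⟩
  ∑ q (λ t → coeff (p′ *ₜ t) m)   ≡⟨ coeff-*P-∑ˡ p′ q m ⟨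
  coeff (p′ *P q) m               ∎
  where open ≡-Reasoning

*P-congʳ : ∀ p {q q′} → q ≋ q′ → p *P q ≋ p *P q′
*P-congʳ p {q} {q′} q≋q′ = coeffwise λ m → begin
  coeff (p *P q) m                ≡⟨ coeff-*P-∑ʳ p q m ⟩
  ∑ p (λ t → coeff (q *ₜ t) m)    ≡⟨ ∑-cong p (λ t → coeff-≡ (*ₜ-cong t q≋q′) m) ⟩
  ∑ p (λ t → coeff (q′ *ₜ t) m)   ≡⟨ coeff-*P-∑ʳ p q′ m ⟨
  coeff (p *P q′) m               ∎
  where open ≡-Reasoning

≋-double⇒0P : ∀ {p} → p ≋ p +P p → p ≋ 0P
≋-double⇒0P {p} (coeffwise e) = coeffwise λ m →
  sym (∙-cancelʳ (coeff p m) 0ℚ (coeff p m) (trans (ℚ.+-identityˡ _) (trans (e m) (coeff-++ p p m))))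
  where open GroupProperties ℚ.+-0-group using (∙-cancelʳ)

mono : Mono → Poly
mono e = (1ℚ , e) ∷ []

poly : List Mono → Poly
poly = map (1ℚ ,_)

mono-*P-poly : ∀ e F → mono e *P poly F ≡ poly (map (e ⊕_) F)
mono-*P-poly e []      = refl
mono-*P-poly e (f ∷ F) = cong ((1ℚ , e ⊕ f) ∷_) (mono-*P-poly e F)

poly-*P-mono : ∀ E f → poly E *P mono f ≡ poly (map (_⊕ f) E)
poly-*P-mono []      f = refl
poly-*P-mono (e ∷ E) f = cong ((1ℚ , e ⊕ f) ∷_) (poly-*P-mono E f)

*P-identityʳ : ∀ p → p *P 1P ≡ p
*P-identityʳ []            = refl
*P-identityʳ ((c , e) ∷ p) = cong₂ _∷_ (cong₂ _,_ (ℚ.*-identityʳ c) (⊕-identityʳ e)) (*P-identityʳ p)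

*P-identityˡ : ∀ p → 1P *P p ≡ p
*P-identityˡ p = trans (List.++-identityʳ _)
  (trans (List.map-cong (λ (c , e) → cong₂ _,_ (ℚ.*-identityˡ c) (⊕-identityˡ e)) p) (List.map-id p))

-- Derivations on sums of monomials

module Derivation {D : Poly → Poly} (isD : IsDerivation D) where
  open IsDerivation isD
  open ≋-Reasoning

  D-cong : ∀ {p q} → p ≋ q → D p ≋ D q
  D-cong (coeffwise e) = coeffwise (resp e)

  D-+P : ∀ p q → D (p +P q) ≋ D p +P D q
  D-+P p q = coeffwise (additive p q)

  D-*P : ∀ p q → D (p *P q) ≋ D p *P q +P p *P D q
  D-*P p q = coeffwise (leibniz p q)

  D-0P : D 0P ≋ 0P
  D-0P = ≋-double⇒0P (D-+P 0P 0P)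

  D-1P : D 1P ≋ 0P
  D-1P = ≋-double⇒0P (begin
    D (1P *P 1P)                   ≈⟨ D-*P 1P 1P ⟩
    D 1P *P 1P +P 1P *P D 1P       ≡⟨ cong₂ _+P_ (*P-identityʳ (D 1P)) (*P-identityˡ (D 1P)) ⟩
    D 1P +P D 1P                   ∎)

  D-mono-⊕ : ∀ {e f E F} → D (mono e) ≋ poly E → D (mono f) ≋ poly F →
             D (mono (e ⊕ f)) ≋ poly (map (_⊕ f) E ++ map (e ⊕_) F)
  D-mono-⊕ {e} {f} {E} {F} De Df = begin
    D (mono e *P mono f)                          ≈⟨ D-*P (mono e) (mono f) ⟩
    D (mono e) *P mono f +P mono e *P D (mono f)  ≈⟨ +P-cong (*P-congˡ (mono f) De) (*P-congʳ (mono e) Df) ⟩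
    poly E *P mono f +P mono e *P poly F          ≡⟨ cong₂ _+P_ (poly-*P-mono E f) (mono-*P-poly e F) ⟩
    poly (map (_⊕ f) E) ++ poly (map (e ⊕_) F)    ≡⟨ List.map-++ (1ℚ ,_) (map (_⊕ f) E) _ ⟨
    poly (map (_⊕ f) E ++ map (e ⊕_) F)           ∎

  D-poly : ∀ {X : Set} (g : X → Mono) (F : X → List Mono) xs →
           (∀ {x} → x ∈ xs → D (mono (g x)) ≋ poly (F x)) →
           D (poly (map g xs)) ≋ poly (concatMap F xs)
  D-poly g F []       DF = D-0P
  D-poly g F (x ∷ xs) DF = begin
    D (mono (g x) +P poly (map g xs))          ≈⟨ D-+P (mono (g x)) (poly (map g xs)) ⟩
    D (mono (g x)) +P D (poly (map g xs))      ≈⟨ +P-cong (DF (here refl)) (D-poly g F xs (DF ∘ there)) ⟩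
    poly (F x) ++ poly (concatMap F xs)        ≡⟨ List.map-++ (1ℚ ,_) (F x) _ ⟨
    poly (F x ++ concatMap F xs)               ∎

-- Permutations, built by inserting a new maximum

concatMap-unique : {A B : Set} (f : A → List B) {xs : List A} → Unique xs →
                   (∀ {x} → x ∈ xs → Unique (f x)) →
                   (∀ {x y z} → x ∈ xs → y ∈ xs → z ∈ f x → z ∈ f y → x ≡ y) →
                   Unique (concatMap f xs)
concatMap-unique f {[]}     _          _     _      = []
concatMap-unique f {x ∷ xs} (x∉ ∷ uxs) ufx   f-disj =
  Unique.++⁺ (ufx (here refl)) (concatMap-unique f uxs (ufx ∘ there) (λ p q → f-disj (there p) (there q)))
    disjoint
  where
  disjoint : ∀ {z} → ¬ (z ∈ f x × z ∈ concatMap f xs)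
  disjoint (z∈fx , z∈fxs) with find (∈-concatMap⁻ f {xs = xs} z∈fxs)
  ... | y , y∈xs , z∈fy = All.lookup x∉ y∈xs (f-disj (here refl) (there y∈xs) z∈fx z∈fy)

concatMap-↭ : {A B : Set} {f g : A → List B} (xs : List A) →
              (∀ {x} → x ∈ xs → f x ↭ g x) → concatMap f xs ↭ concatMap g xs
concatMap-↭ []       f↭g = ↭-refl
concatMap-↭ (x ∷ xs) f↭g = ↭.++⁺ (f↭g (here refl)) (concatMap-↭ xs (f↭g ∘ there))

swap-ends : {A : Set} (x y : A) (xs : List A) → x ∷ (xs ∷ʳ y) ↭ y ∷ (xs ∷ʳ x)
swap-ends x y xs = begin
  x ∷ (xs ∷ʳ y)   ↭⟨ prep x (↭-sym (↭.∷↭∷ʳ y xs)) ⟩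
  x ∷ y ∷ xs      ↭⟨ swap x y ↭-refl ⟩
  y ∷ x ∷ xs      ↭⟨ prep y (↭.∷↭∷ʳ x xs) ⟩
  y ∷ (xs ∷ʳ x)   ∎
  where open ↭.PermutationReasoning

map-∷ʳ : {A B : Set} (f : A → B) (xs : List A) (x : A) → map f (xs ∷ʳ x) ≡ map f xs ∷ʳ f x
map-∷ʳ f xs x = List.map-++ f xs (x ∷ [])

Unique-resp-↭ : {A : Set} {xs ys : List A} → xs ↭ ys → Unique xs → Unique ys
Unique-resp-↭ {A} p = ↭ₛ.Unique-resp-↭ (setoid A) (↭⇒↭ₛ p)

All-<-tighten : ∀ {k w} → All (_< suc k) w → k ∉ w → All (_< k) w
All-<-tighten {k} {w} w<1+k k∉w =
  All.zipWith (λ (a<1+k , k≢a) → ℕ.≤∧≢⇒< (ℕ.≤-pred a<1+k) (k≢a ∘ sym)) (w<1+k , ¬Any⇒All¬ w k∉w)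

words-unique : ∀ k {A} → Unique A → Unique (words k A)
words-unique zero    uA = [] ∷ []
words-unique (suc k) {A} uA =
  concatMap-unique _ uA (λ _ → Unique.map⁺ List.∷-injectiveʳ (words-unique k uA)) sameHead
  where
  sameHead : ∀ {a b z} → a ∈ A → b ∈ A → z ∈ map (a ∷_) (words k A) → z ∈ map (b ∷_) (words k A) → a ≡ b
  sameHead _ _ z∈ z∈′ with ∈-map⁻ _ z∈ | ∈-map⁻ _ z∈′
  ... | _ , _ , refl | _ , _ , eq = List.∷-injectiveˡ eq

∈-words⁻ : ∀ k {A w} → w ∈ words k A → length w ≡ k × All (_∈ A) w
∈-words⁻ zero    (here refl) = refl , []
∈-words⁻ (suc k) {A} w∈ with find (∈-concatMap⁻ (λ a → map (a ∷_) (words k A)) {xs = A} w∈)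
... | a , a∈A , w∈′ with ∈-map⁻ (a ∷_) w∈′
... | v , v∈ , refl = cong suc (proj₁ (∈-words⁻ k v∈)) , a∈A ∷ proj₂ (∈-words⁻ k v∈)

∈-words⁺ : ∀ {A} w → All (_∈ A) w → w ∈ words (length w) A
∈-words⁺     []      []           = here refl
∈-words⁺ {A} (a ∷ w) (a∈A ∷ w⊆A) =
  ∈-concatMap⁺ (λ a → map (a ∷_) (words (length w) A)) (lose a∈A (∈-map⁺ (a ∷_) (∈-words⁺ w w⊆A)))

record IsPermutation (m : ℕ) (w : List ℕ) : Set where
  field
    unique  : Unique w
    length≡ : length w ≡ m
    bounded : All (_< m) w

∈-perms⁻ : ∀ m {w} → w ∈ perms m → IsPermutation m w
∈-perms⁻ m w∈ with ∈-filter⁻ unique? {xs = words m (upTo m)} w∈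
... | w∈words , uw = record
  { unique  = uw
  ; length≡ = proj₁ (∈-words⁻ m w∈words)
  ; bounded = All.map ∈-upTo⁻ (proj₂ (∈-words⁻ m w∈words))
  }

∈-perms⁺ : ∀ m {w} → IsPermutation m w → w ∈ perms m
∈-perms⁺ m {w} record { unique = uw ; length≡ = refl ; bounded = w<m } =
  ∈-filter⁺ unique? (∈-words⁺ w (All.map ∈-upTo⁺ w<m)) uw

perms-unique : ∀ m → Unique (perms m)
perms-unique m = Unique.filter⁺ unique? (words-unique m (Unique.upTo⁺ m))

insertions : {A : Set} → A → List A → List (List A)
insertions x []      = (x ∷ []) ∷ []
insertions x (a ∷ w) = (x ∷ a ∷ w) ∷ map (a ∷_) (insertions x w)

∈-insertions⇒↭ : {A : Set} {x : A} (π : List A) {w : List A} → w ∈ insertions x π → w ↭ x ∷ π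
∈-insertions⇒↭ []      (here refl) = ↭-refl
∈-insertions⇒↭ (a ∷ π) (here refl) = ↭-refl
∈-insertions⇒↭ (a ∷ π) (there w∈)  with ∈-map⁻ (a ∷_) w∈
... | v , v∈ , refl = ↭-trans (prep a (∈-insertions⇒↭ π v∈)) (swap a _ ↭-refl)

++-∈-insertions : {A : Set} {x : A} (ys zs : List A) → ys ++ x ∷ zs ∈ insertions x (ys ++ zs)
++-∈-insertions []       []       = here refl
++-∈-insertions []       (z ∷ zs) = here refl
++-∈-insertions (y ∷ ys) zs       = there (∈-map⁺ (y ∷_) (++-∈-insertions ys zs))

insertions-unique : {A : Set} {x : A} (π : List A) → x ∉ π → Unique (insertions x π)
insertions-unique []      x∉π = [] ∷ []
insertions-unique {x = x} (a ∷ π) x∉π =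
  All.tabulate (λ w∈ → headDiffers (∈-map⁻ (a ∷_) w∈))
    ∷ Unique.map⁺ List.∷-injectiveʳ (insertions-unique π (x∉π ∘ there))
  where
  headDiffers : ∀ {w} → ∃ (λ v → v ∈ insertions x π × w ≡ a ∷ v) → x ∷ a ∷ π ≢ w
  headDiffers (_ , _ , refl) refl = x∉π (here refl)

removeAll : ℕ → List ℕ → List ℕ
removeAll x = List.filter (¬? ∘ (x ℕ.≟_))

∈-insertions⇒removeAll≡ : ∀ {x} π {w} → w ∈ insertions x π → removeAll x w ≡ removeAll x π
∈-insertions⇒removeAll≡ {x} []      (here refl) = List.filter-reject (¬? ∘ (x ℕ.≟_)) (_$ refl)
∈-insertions⇒removeAll≡ {x} (a ∷ π) (here refl) = List.filter-reject (¬? ∘ (x ℕ.≟_)) (_$ refl)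
∈-insertions⇒removeAll≡ {x} (a ∷ π) (there w∈) with ∈-map⁻ (a ∷_) w∈
... | v , v∈ , refl with x ℕ.≟ a
...   | yes x≡a = begin
  removeAll x (a ∷ v)  ≡⟨ List.filter-reject (¬? ∘ (x ℕ.≟_)) (_$ x≡a) ⟩
  removeAll x v        ≡⟨ ∈-insertions⇒removeAll≡ π v∈ ⟩
  removeAll x π        ≡⟨ List.filter-reject (¬? ∘ (x ℕ.≟_)) (_$ x≡a) ⟨
  removeAll x (a ∷ π)  ∎
  where open ≡-Reasoning
...   | no x≢a  = begin
  removeAll x (a ∷ v)      ≡⟨ List.filter-accept (¬? ∘ (x ℕ.≟_)) x≢a ⟩
  a ∷ removeAll x v        ≡⟨ cong (a ∷_) (∈-insertions⇒removeAll≡ π v∈) ⟩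
  a ∷ removeAll x π        ≡⟨ List.filter-accept (¬? ∘ (x ℕ.≟_)) x≢a ⟨
  removeAll x (a ∷ π)      ∎
  where open ≡-Reasoning

insertions-disjoint : ∀ {x π π′ w} → x ∉ π → x ∉ π′ → w ∈ insertions x π → w ∈ insertions x π′ → π ≡ π′
insertions-disjoint {x} {π} {π′} {w} x∉π x∉π′ w∈ w∈′ = begin
  π                ≡⟨ removeAll-∉ x∉π ⟨
  removeAll x π    ≡⟨ ∈-insertions⇒removeAll≡ π w∈ ⟨
  removeAll x w    ≡⟨ ∈-insertions⇒removeAll≡ π′ w∈′ ⟩
  removeAll x π′   ≡⟨ removeAll-∉ x∉π′ ⟩
  π′               ∎
  where
  open ≡-Reasoning
  removeAll-∉ : ∀ {ρ} → x ∉ ρ → removeAll x ρ ≡ ρ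
  removeAll-∉ {ρ} x∉ρ = List.filter-all (¬? ∘ (x ℕ.≟_)) (¬Any⇒All¬ ρ x∉ρ)

remove-max : ∀ {k} ys zs → Unique (ys ++ k ∷ zs) → All (_< suc k) (ys ++ k ∷ zs) →
             Unique (ys ++ zs) × All (_< k) (ys ++ zs)
remove-max {k} ys zs u w<1+k
  with Unique-resp-↭ (↭.shift k ys zs) u | ↭.All-resp-↭ (↭.shift k ys zs) w<1+k
... | k∉ ∷ u′ | _ ∷ w′<1+k = u′ , All-<-tighten w′<1+k (All¬⇒¬Any k∉)

unique-bounded⇒length≤ : ∀ k {w} → Unique w → All (_< k) w → length w ≤ k
unique-bounded⇒length≤ zero    {[]}    _ _        = z≤n
unique-bounded⇒length≤ zero    {_ ∷ _} _ (() ∷ _)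
unique-bounded⇒length≤ (suc k) {w}     u w<1+k with k ∈? w
... | no k∉w  = ℕ.m≤n⇒m≤1+n (unique-bounded⇒length≤ k u (All-<-tighten w<1+k k∉w))
... | yes k∈w with ∈-∃++ k∈w
...   | ys , zs , refl = begin
  length (ys ++ k ∷ zs)    ≡⟨ ↭.↭-length (↭.shift k ys zs) ⟩
  suc (length (ys ++ zs))  ≤⟨ s≤s (unique-bounded⇒length≤ k (proj₁ removed) (proj₂ removed)) ⟩
  suc k                    ∎
  where
  open ℕ.≤-Reasoning
  removed : Unique (ys ++ zs) × All (_< k) (ys ++ zs)
  removed = remove-max ys zs u w<1+k

max∈permutation : ∀ {n π} → IsPermutation (suc n) π → n ∈ π
max∈permutation {n} {π} isPerm with n ∈? π
... | yes n∈π = n∈π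
... | no n∉π  = ⊥-elim (ℕ.1+n≰n (subst (_≤ n) length≡ (unique-bounded⇒length≤ n unique (All-<-tighten bounded n∉π))))
  where open IsPermutation isPerm

∉-permutation : ∀ {m π} → IsPermutation m π → m ∉ π
∉-permutation isPerm m∈π = ℕ.<-irrefl refl (All.lookup (IsPermutation.bounded isPerm) m∈π)

permutation-insert : ∀ {m π w} → IsPermutation m π → w ∈ insertions m π → IsPermutation (suc m) w
permutation-insert {m} {π} {w} isPerm w∈ = record
  { unique  = Unique-resp-↭ m∷π↭w (¬Any⇒All¬ π (∉-permutation isPerm) ∷ unique)
  ; length≡ = trans (sym (↭.↭-length m∷π↭w)) (cong suc length≡)
  ; bounded = ↭.All-resp-↭ m∷π↭w (ℕ.n<1+n m ∷ All.map ℕ.m<n⇒m<1+n bounded)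
  }
  where
  open IsPermutation isPerm
  m∷π↭w : m ∷ π ↭ w
  m∷π↭w = ↭-sym (∈-insertions⇒↭ π w∈)

permutation-remove : ∀ {m} ys zs → IsPermutation (suc m) (ys ++ m ∷ zs) → IsPermutation m (ys ++ zs)
permutation-remove {m} ys zs isPerm = record
  { unique  = proj₁ (remove-max ys zs unique bounded)
  ; length≡ = ℕ.suc-injective (trans (sym (↭.↭-length (↭.shift m ys zs))) length≡)
  ; bounded = proj₂ (remove-max ys zs unique bounded)
  }
  where open IsPermutation isPerm

perms-suc-↭ : ∀ m → perms (suc m) ↭ concatMap (insertions m) (perms m)
perms-suc-↭ m = ∼bag⇒↭ (unique∧set⇒bag (perms-unique (suc m)) unique-insertions (mk⇔ to from))
  where
  m∉ : ∀ {π} → π ∈ perms m → m ∉ π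
  m∉ = ∉-permutation ∘ ∈-perms⁻ m

  unique-insertions : Unique (concatMap (insertions m) (perms m))
  unique-insertions = concatMap-unique (insertions m) (perms-unique m)
    (λ π∈ → insertions-unique _ (m∉ π∈)) (λ π∈ π′∈ → insertions-disjoint (m∉ π∈) (m∉ π′∈))

  to : ∀ {w} → w ∈ perms (suc m) → w ∈ concatMap (insertions m) (perms m)
  to w∈ with ∈-∃++ (max∈permutation (∈-perms⁻ (suc m) w∈))
  ... | ys , zs , refl = ∈-concatMap⁺ (insertions m)
    (lose (∈-perms⁺ m (permutation-remove ys zs (∈-perms⁻ (suc m) w∈))) (++-∈-insertions ys zs))

  from : ∀ {w} → w ∈ concatMap (insertions m) (perms m) → w ∈ perms (suc m)
  from w∈ with find (∈-concatMap⁻ (insertions m) {xs = perms m} w∈)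
  ... | π , π∈ , w∈ins = ∈-perms⁺ (suc m) (permutation-insert (∈-perms⁻ m π∈) w∈ins)

-- The statistics basc, des and suc under insertion of a new maximum

stat : List ℕ → Mono
stat w = 0 ∷ 0 ∷ basc w ∷ des w ∷ sucs w ∷ []

pairStat : ℕ → ℕ → Mono
pairStat a b = 0 ∷ 0 ∷ (if does (suc (suc a) ℕ.≤? b) then 1 else 0)
                     ∷ (if does (b ℕ.<? a) then 1 else 0)
                     ∷ (if does (b ℕ.≟ suc a) then 1 else 0) ∷ []

ex ey es exy eLM : Mono
ex  = 0 ∷ 0 ∷ 1 ∷ 0 ∷ 0 ∷ []
ey  = 0 ∷ 0 ∷ 0 ∷ 1 ∷ 0 ∷ []
es  = 0 ∷ 0 ∷ 0 ∷ 0 ∷ 1 ∷ []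
exy = 0 ∷ 0 ∷ 1 ∷ 1 ∷ 0 ∷ []
eLM = 1 ∷ 1 ∷ 0 ∷ 0 ∷ 0 ∷ []

pairStat-basc : ∀ {a b} → suc (suc a) ≤ b → pairStat a b ≡ ex
pairStat-basc {a} {b} 2+a≤b
  rewrite dec-true  (suc (suc a) ℕ.≤? b) 2+a≤b
        | dec-false (b ℕ.<? a)      (ℕ.<-asym (ℕ.<-trans (ℕ.n<1+n a) 2+a≤b))
        | dec-false (b ℕ.≟ suc a)   (λ b≡1+a → ℕ.<-irrefl (sym b≡1+a) 2+a≤b) = refl

pairStat-des : ∀ {a b} → b < a → pairStat a b ≡ ey
pairStat-des {a} {b} b<a
  rewrite dec-false (suc (suc a) ℕ.≤? b) (ℕ.<⇒≱ (ℕ.m<n⇒m<1+n (ℕ.m<n⇒m<1+n b<a)))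
        | dec-true  (b ℕ.<? a)      b<a
        | dec-false (b ℕ.≟ suc a)   (λ b≡1+a → ℕ.<-asym b<a (subst (a <_) (sym b≡1+a) (ℕ.n<1+n a))) = refl

pairStat-suc : ∀ a → pairStat a (suc a) ≡ es
pairStat-suc a
  rewrite dec-false (suc (suc a) ℕ.≤? suc a) (ℕ.<-irrefl refl)
        | dec-false (suc a ℕ.<? a)    (ℕ.<-asym (ℕ.n<1+n a))
        | dec-true  (suc a ℕ.≟ suc a) refl = refl

pairStat∈ : ∀ {a b} → a ≢ b → pairStat a b ∈ ex ∷ ey ∷ es ∷ []
pairStat∈ {a} {b} a≢b with ℕ.<-cmp a b
... | tri≈ _ a≡b _ = ⊥-elim (a≢b a≡b)
... | tri> _ _ b<a = there (here (pairStat-des b<a))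
... | tri< a<b _ _ with ℕ.m≤n⇒m<n∨m≡n a<b
...   | inj₁ 2+a≤b = here (pairStat-basc 2+a≤b)
...   | inj₂ refl  = there (there (here (pairStat-suc a)))

∂stat : List ℕ → List Mono
∂stat []          = []
∂stat (a ∷ [])    = []
∂stat (a ∷ b ∷ w) = (exy ⊕ stat (b ∷ w)) ∷ map (pairStat a b ⊕_) (∂stat (b ∷ w))

map-stat-∷-∷ : ∀ a b (ws : List (List ℕ)) →
               map (stat ∘ (a ∷_)) (map (b ∷_) ws) ≡ map (pairStat a b ⊕_) (map (stat ∘ (b ∷_)) ws)
map-stat-∷-∷ a b ws = trans (sym (List.map-∘ ws)) (List.map-∘ ws)

stat-insertions-below : ∀ {n} a w → All (_< n) (a ∷ w) →
  map (stat ∘ (a ∷_)) (insertions (suc n) w) ≡ ∂stat (a ∷ w) ∷ʳ (ex ⊕ stat (a ∷ w))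
stat-insertions-below {n} a []      (a<n ∷ []) =
  cong (λ e → (e ⊕ stat (a ∷ [])) ∷ []) (pairStat-basc (s≤s a<n))
stat-insertions-below {n} a (b ∷ r) (a<n ∷ b∷r<n@(b<n ∷ _)) = begin
  stat (a ∷ suc n ∷ b ∷ r) ∷ map (stat ∘ (a ∷_)) (map (b ∷_) X)
    ≡⟨ cong₂ (λ e f → e ⊕ (f ⊕ v) ∷ map (stat ∘ (a ∷_)) (map (b ∷_) X))
             (pairStat-basc (s≤s a<n)) (pairStat-des (ℕ.m<n⇒m<1+n b<n)) ⟩
  exy ⊕ v ∷ map (stat ∘ (a ∷_)) (map (b ∷_) X)
    ≡⟨ cong (exy ⊕ v ∷_) (map-stat-∷-∷ a b X) ⟩
  exy ⊕ v ∷ map (τ ⊕_) (map (stat ∘ (b ∷_)) X)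
    ≡⟨ cong (λ ws → exy ⊕ v ∷ map (τ ⊕_) ws) (stat-insertions-below b r b∷r<n) ⟩
  exy ⊕ v ∷ map (τ ⊕_) (∂stat (b ∷ r) ∷ʳ (ex ⊕ v))
    ≡⟨ cong (exy ⊕ v ∷_) (map-∷ʳ (τ ⊕_) (∂stat (b ∷ r)) _) ⟩
  exy ⊕ v ∷ (map (τ ⊕_) (∂stat (b ∷ r)) ∷ʳ (τ ⊕ (ex ⊕ v)))
    ≡⟨ cong (λ e → exy ⊕ v ∷ (map (τ ⊕_) (∂stat (b ∷ r)) ∷ʳ e)) (⊕-leftComm τ ex v) ⟩
  ∂stat (a ∷ b ∷ r) ∷ʳ (ex ⊕ stat (a ∷ b ∷ r)) ∎
  where
  open ≡-Reasoning
  X : List (List ℕ)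
  X = insertions (suc n) r
  v τ : Mono
  v = stat (b ∷ r)
  τ = pairStat a b

stat-insertions-max : ∀ {n} a w → Unique (a ∷ w) → All (_< suc n) (a ∷ w) → n ∈ a ∷ w →
  map (stat ∘ (a ∷_)) (insertions (suc n) w) ↭ ∂stat (a ∷ w) ∷ʳ (es ⊕ stat (a ∷ w))
stat-insertions-max {n} n []      _           _ (here refl) =
  ↭-reflexive (cong (λ e → (e ⊕ stat (n ∷ [])) ∷ []) (pairStat-suc n))
stat-insertions-max {n} n (b ∷ r) (n∉ ∷ _)   (_ ∷ b∷r<1+n) (here refl) = begin
  stat (n ∷ suc n ∷ b ∷ r) ∷ map (stat ∘ (n ∷_)) (map (b ∷_) X)
    ≡⟨ cong₂ (λ e f → e ⊕ (f ⊕ v) ∷ map (stat ∘ (n ∷_)) (map (b ∷_) X))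
             (pairStat-suc n) (pairStat-des (ℕ.m<n⇒m<1+n b<n)) ⟩
  es ⊕ (ey ⊕ v) ∷ map (stat ∘ (n ∷_)) (map (b ∷_) X)
    ≡⟨ cong (es ⊕ (ey ⊕ v) ∷_) (map-stat-∷-∷ n b X) ⟩
  es ⊕ (ey ⊕ v) ∷ map (pairStat n b ⊕_) (map (stat ∘ (b ∷_)) X)
    ≡⟨ cong₂ (λ f ws → es ⊕ (ey ⊕ v) ∷ map (f ⊕_) ws) (pairStat-des b<n) (stat-insertions-below b r b∷r<n) ⟩
  es ⊕ (ey ⊕ v) ∷ map (ey ⊕_) (∂stat (b ∷ r) ∷ʳ (ex ⊕ v))
    ≡⟨ cong (es ⊕ (ey ⊕ v) ∷_) (map-∷ʳ (ey ⊕_) (∂stat (b ∷ r)) _) ⟩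
  es ⊕ (ey ⊕ v) ∷ (map (ey ⊕_) (∂stat (b ∷ r)) ∷ʳ (exy ⊕ v))
    -- insertion after n gives the extra s, insertion at the end the term of the pair (n, b)
    ↭⟨ swap-ends _ _ _ ⟩
  exy ⊕ v ∷ (map (ey ⊕_) (∂stat (b ∷ r)) ∷ʳ (es ⊕ (ey ⊕ v)))
    ≡⟨ cong (λ f → exy ⊕ v ∷ (map (f ⊕_) (∂stat (b ∷ r)) ∷ʳ (es ⊕ (f ⊕ v)))) (pairStat-des b<n) ⟨
  ∂stat (n ∷ b ∷ r) ∷ʳ (es ⊕ stat (n ∷ b ∷ r)) ∎
  where
  open ↭.PermutationReasoning
  X : List (List ℕ)
  X = insertions (suc n) r
  v : Mono
  v = stat (b ∷ r)
  b∷r<n : All (_< n) (b ∷ r)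
  b∷r<n = All-<-tighten b∷r<1+n (All¬⇒¬Any n∉)
  b<n : b < n
  b<n = All.head b∷r<n
stat-insertions-max {n} a (b ∷ r) (a∉ ∷ u)  (a<1+n ∷ b∷r<1+n) (there n∈b∷r) = begin
  stat (a ∷ suc n ∷ b ∷ r) ∷ map (stat ∘ (a ∷_)) (map (b ∷_) X)
    ≡⟨ cong₂ (λ e f → e ⊕ (f ⊕ v) ∷ map (stat ∘ (a ∷_)) (map (b ∷_) X))
             (pairStat-basc (s≤s a<n)) (pairStat-des (All.head b∷r<1+n)) ⟩
  exy ⊕ v ∷ map (stat ∘ (a ∷_)) (map (b ∷_) X)
    ≡⟨ cong (exy ⊕ v ∷_) (map-stat-∷-∷ a b X) ⟩
  exy ⊕ v ∷ map (τ ⊕_) (map (stat ∘ (b ∷_)) X)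
    ↭⟨ prep (exy ⊕ v) (↭.map⁺ (τ ⊕_) (stat-insertions-max b r u b∷r<1+n n∈b∷r)) ⟩
  exy ⊕ v ∷ map (τ ⊕_) (∂stat (b ∷ r) ∷ʳ (es ⊕ v))
    ≡⟨ cong (exy ⊕ v ∷_) (map-∷ʳ (τ ⊕_) (∂stat (b ∷ r)) _) ⟩
  exy ⊕ v ∷ (map (τ ⊕_) (∂stat (b ∷ r)) ∷ʳ (τ ⊕ (es ⊕ v)))
    ≡⟨ cong (λ e → exy ⊕ v ∷ (map (τ ⊕_) (∂stat (b ∷ r)) ∷ʳ e)) (⊕-leftComm τ es v) ⟩
  ∂stat (a ∷ b ∷ r) ∷ʳ (es ⊕ stat (a ∷ b ∷ r)) ∎
  where
  open ↭.PermutationReasoning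
  X : List (List ℕ)
  X = insertions (suc n) r
  v τ : Mono
  v = stat (b ∷ r)
  τ = pairStat a b
  a<n : a < n
  a<n = ℕ.≤∧≢⇒< (ℕ.≤-pred a<1+n) (λ a≡n → All.lookup a∉ n∈b∷r a≡n)

stat-insertions : ∀ {n} π → Unique π → All (_< suc n) π → n ∈ π →
  map stat (insertions (suc n) π) ↭ (ey ⊕ stat π) ∷ (es ⊕ stat π) ∷ ∂stat π
stat-insertions {n} (a ∷ w) u a∷w<1+n@(a<1+n ∷ _) n∈a∷w = begin
  stat (suc n ∷ a ∷ w) ∷ map stat (map (a ∷_) (insertions (suc n) w))
    ≡⟨ cong₂ (λ e ws → e ⊕ stat (a ∷ w) ∷ ws) (pairStat-des a<1+n) (sym (List.map-∘ (insertions (suc n) w))) ⟩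
  ey ⊕ stat (a ∷ w) ∷ map (stat ∘ (a ∷_)) (insertions (suc n) w)
    ↭⟨ prep _ (stat-insertions-max a w u a∷w<1+n n∈a∷w) ⟩
  ey ⊕ stat (a ∷ w) ∷ (∂stat (a ∷ w) ∷ʳ (es ⊕ stat (a ∷ w)))
    ↭⟨ prep _ (↭-sym (↭.∷↭∷ʳ _ _)) ⟩
  ey ⊕ stat (a ∷ w) ∷ es ⊕ stat (a ∷ w) ∷ ∂stat (a ∷ w) ∎
  where open ↭.PermutationReasoning

varx-^P : ∀ k → varx ^P k ≡ mono (0 ∷ 0 ∷ k ∷ 0 ∷ 0 ∷ [])
varx-^P zero    = refl
varx-^P (suc k) = cong (varx *P_) (varx-^P k)

vary-^P : ∀ k → vary ^P k ≡ mono (0 ∷ 0 ∷ 0 ∷ k ∷ 0 ∷ [])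
vary-^P zero    = refl
vary-^P (suc k) = cong (vary *P_) (vary-^P k)

vars-^P : ∀ k → vars ^P k ≡ mono (0 ∷ 0 ∷ 0 ∷ 0 ∷ k ∷ [])
vars-^P zero    = refl
vars-^P (suc k) = cong (vars *P_) (vars-^P k)

monomial : List ℕ → Poly
monomial π = varx ^P basc π *P vary ^P des π *P vars ^P sucs π

monomial≡mono-stat : ∀ π → monomial π ≡ mono (stat π)
monomial≡mono-stat π
  rewrite varx-^P (basc π) | vary-^P (des π) | vars-^P (sucs π)
        | ℕ.+-identityʳ (basc π) | ℕ.+-identityʳ (basc π) | ℕ.+-identityʳ (des π) = refl

sumP-monomial : ∀ πs → sumP (map monomial πs) ≡ poly (map stat πs)
sumP-monomial []       = refl
sumP-monomial (π ∷ πs) = cong₂ _+P_ (monomial≡mono-stat π) (sumP-monomial πs)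

statLM : List ℕ → Mono
statLM π = eLM ⊕ stat π

∂statLM : List ℕ → List Mono
∂statLM π = map (eLM ⊕_) ((ey ⊕ stat π) ∷ (es ⊕ stat π) ∷ ∂stat π)

statLM-insertions : ∀ n → concatMap ∂statLM (perms (suc n)) ↭ map statLM (perms (suc (suc n)))
statLM-insertions n = begin
  concatMap ∂statLM (perms (suc n))
    ↭⟨ concatMap-↭ (perms (suc n)) (λ π∈ → ↭.map⁺ (eLM ⊕_) (↭-sym (stat-insertions-perm π∈))) ⟩
  concatMap (map (eLM ⊕_) ∘ map stat ∘ insertions (suc n)) (perms (suc n))
    ≡⟨ List.concatMap-cong (λ π → sym (List.map-∘ (insertions (suc n) π))) (perms (suc n)) ⟩
  concatMap (map statLM ∘ insertions (suc n)) (perms (suc n))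
    ≡⟨ List.map-concatMap statLM (insertions (suc n)) (perms (suc n)) ⟨
  map statLM (concatMap (insertions (suc n)) (perms (suc n)))
    ↭⟨ ↭.map⁺ statLM (↭-sym (perms-suc-↭ (suc n))) ⟩
  map statLM (perms (suc (suc n))) ∎
  where
  open ↭.PermutationReasoning
  stat-insertions-perm : ∀ {π} → π ∈ perms (suc n) →
    map stat (insertions (suc n) π) ↭ (ey ⊕ stat π) ∷ (es ⊕ stat π) ∷ ∂stat π
  stat-insertions-perm {π} π∈ = stat-insertions π unique bounded (max∈permutation isPerm)
    where
    isPerm : IsPermutation (suc n) π
    isPerm = ∈-perms⁻ (suc n) π∈
    open IsPermutation isPerm

module _ {D : Poly → Poly} (isD : IsDerivation D)
         (DL : D varL ≈ varL *P vary) (DM : D varM ≈ varM *P vars)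
         (Ds : D vars ≈ varx *P vary) (Dx : D varx ≈ varx *P vary) (Dy : D vary ≈ varx *P vary) where
  open Derivation isD
  open ≋-Reasoning

  D-pairStat : ∀ {a b} → a ≢ b → D (mono (pairStat a b)) ≋ mono exy
  D-pairStat a≢b = All.lookup D-generators (pairStat∈ a≢b)
    where
    D-generators : All (λ e → D (mono e) ≋ mono exy) (ex ∷ ey ∷ es ∷ [])
    D-generators = coeffwise Dx ∷ coeffwise Dy ∷ coeffwise Ds ∷ []

  D-stat : ∀ {w} → Linked _≢_ w → D (mono (stat w)) ≋ poly (∂stat w)
  D-stat []           = D-1P
  D-stat [-]          = D-1P
  D-stat (a≢b ∷ b∷w) = D-mono-⊕ (D-pairStat a≢b) (D-stat b∷w)

  D-LM : D (mono eLM) ≋ poly (eLM ⊕ ey ∷ eLM ⊕ es ∷ [])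
  D-LM = D-mono-⊕ {E = _ ∷ []} {F = _ ∷ []} (coeffwise DL) (coeffwise DM)

  D-statLM : ∀ {π} → Linked _≢_ π → D (mono (statLM π)) ≋ poly (∂statLM π)
  D-statLM π-linked = D-mono-⊕ D-LM (D-stat π-linked)

  iter-D-LM : ∀ n → iter n D (varL *P varM) ≋ poly (map statLM (perms (suc n)))
  iter-D-LM zero    = ≡⇒≋ refl
  iter-D-LM (suc n) = begin
    D (iter n D (varL *P varM))                  ≈⟨ D-cong (iter-D-LM n) ⟩
    D (poly (map statLM (perms (suc n))))        ≈⟨ D-poly statLM ∂statLM (perms (suc n)) D-statLM-perm ⟩
    poly (concatMap ∂statLM (perms (suc n)))     ≈⟨ ↭⇒≋ (↭.map⁺ (1ℚ ,_) (statLM-insertions n)) ⟩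
    poly (map statLM (perms (suc (suc n))))      ∎
    where
    D-statLM-perm : ∀ {π} → π ∈ perms (suc n) → D (mono (statLM π)) ≋ poly (∂statLM π)
    D-statLM-perm π∈ = D-statLM (AllPairs⇒Linked (IsPermutation.unique (∈-perms⁻ (suc n) π∈)))

lemma3p5 : (D : Poly → Poly) → IsDerivation D →
           D varL ≈ varL *P vary →
           D varM ≈ varM *P vars →
           D vars ≈ varx *P vary →
           D varx ≈ varx *P vary →
           D vary ≈ varx *P vary →
           (n : ℕ) →
           iter n D (varL *P varM)
             ≈ (varL *P varM) *P
               sumP (map (λ π → varx ^P basc π *P vary ^P des π *P vars ^P sucs π)
                         (perms (suc n)))
lemma3p5 D isD DL DM Ds Dx Dy n = coeff-≡ (begin
  iter n D (varL *P varM)                        ≈⟨ iter-D-LM isD DL DM Ds Dx Dy n ⟩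
  poly (map statLM P)                            ≡⟨ cong poly (List.map-∘ P) ⟩
  poly (map (eLM ⊕_) (map stat P))               ≡⟨ mono-*P-poly eLM (map stat P) ⟨
  mono eLM *P poly (map stat P)                  ≡⟨ cong (mono eLM *P_) (sumP-monomial P) ⟨
  (varL *P varM) *P sumP (map monomial P)        ∎)
  where
  open ≋-Reasoning
  P : List (List ℕ)
  P = perms (suc n)
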